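{- Let $G$ be a graph. If there exist matrices $A\in\mathcal{S}(G)$, $B\in\mathcal{S}(\overline{G})$ and a nowhere-zero vector $\mathbf{x}$ such that $AB=O$ and $B\mathbf{x}$ is nowhere-zero, then $G\sqcup K_1$ is $\beta$-robust.
   Context: For a graph $G$ with vertex set $\{v_1,\dots,v_n\}$, $\mathcal{S}(G)$ is the set of real symmetric $n\times n$ matrices $A=[a_{i,j}]$ such that for $i\neq j$, $a_{i,j}\neq 0$ if and only if $v_iv_j\in E(G)$ (diagonal entries are unrestricted). $\overline{G}$ is the complement of $G$; $G\sqcup K_1$ is $G$ with an added isolated vertex. A vector is nowhere-zero if all its entries are nonzero. $G$ is $\beta$-robust if there exist $A\in\mathcal{S}(G)$, $B\in\mathcal{S}(\overline{G})$ with $AB=O$ and $\ker(B)$ containing a nowhere-zero vector. -}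

module Defs where

open import Level using (Level; _⊔_) renaming (suc to lsuc)
open import Data.Nat using (ℕ; zero; suc)
open import Data.Fin using (Fin; zero; suc)
open import Data.Fin.Properties using () renaming (_≟_ to _≟ᶠ_)
open import Data.Bool using (Bool; true; false; not; _∧_; T)
open import Data.Product using (Σ; ∃; _×_; _,_)
open import Relation.Nullary using (¬_; does)
open import Relation.Binary.PropositionalEquality using (_≡_)
open import Relation.Binary.Structures using (IsTotalOrder)
open import Algebra.Bundles using (CommutativeRing)
open import Function.Bundles using (_⇔_)

-- The real numbers, axiomatised as a complete ordered field
-- (any model of these axioms is isomorphic to ℝ).

record RealField (c ℓ ℓ' : Level) : Set (lsuc (c ⊔ ℓ ⊔ ℓ')) where
  field
    commRing : CommutativeRing c ℓ
  open CommutativeRing commRing public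
  field
    _≤_           : Carrier → Carrier → Set ℓ'
    isTotalOrder  : IsTotalOrder _≈_ _≤_
    +-monoˡ-≤     : ∀ {x y} z → x ≤ y → (x + z) ≤ (y + z)
    *-nonneg      : ∀ {x y} → 0# ≤ x → 0# ≤ y → 0# ≤ (x * y)
    1≉0           : ¬ (1# ≈ 0#)
    inverse       : ∀ x → ¬ (x ≈ 0#) → ∃ λ y → (x * y) ≈ 1#
    complete      : (P : Carrier → Set ℓ') → ∃ P →
                    (∃ λ b → ∀ x → P x → x ≤ b) →
                    ∃ λ s → (∀ x → P x → x ≤ s) ×
                            (∀ b → (∀ x → P x → x ≤ b) → s ≤ b)

record Graph (n : ℕ) : Set where
  field
    adj     : Fin n → Fin n → Bool
    adj-sym : ∀ i j → adj i j ≡ adj j i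
    irrefl  : ∀ i → adj i i ≡ false
open Graph public

complement : ∀ {n} → Graph n → Graph n
complement {n} G = record
  { adj     = λ i j → not (adj G i j) ∧ not (does (i ≟ᶠ j))
  ; adj-sym = sym'
  ; irrefl  = irr
  }
  where
  open import Relation.Binary.PropositionalEquality using (refl; cong₂; cong; sym)

  open import Relation.Nullary using (yes; no)
  sym' : ∀ i j → (not (adj G i j) ∧ not (does (i ≟ᶠ j))) ≡ (not (adj G j i) ∧ not (does (j ≟ᶠ i)))
  sym' i j with i ≟ᶠ j | j ≟ᶠ i
  ... | yes p | yes q = Data.Bool.Properties.∧-zeroʳ (not (adj G i j)) ⟨ trans ⟩ sym (Data.Bool.Properties.∧-zeroʳ (not (adj G j i)))
    where import Data.Bool.Properties
          open import Relation.Binary.PropositionalEquality using (trans)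
          open import Function using (_⟨_⟩_)
  ... | no p  | no q  = cong (λ b → not b ∧ true) (adj-sym G i j)
  ... | yes p | no q  = Data.Empty.⊥-elim (q (sym p))
    where import Data.Empty
  ... | no p  | yes q = Data.Empty.⊥-elim (p (sym q))
    where import Data.Empty
  irr : ∀ i → (not (adj G i i) ∧ not (does (i ≟ᶠ i))) ≡ false
  irr i with i ≟ᶠ i
  ... | yes _ = Data.Bool.Properties.∧-zeroʳ (not (adj G i i))
    where import Data.Bool.Properties
  ... | no ¬p = Data.Empty.⊥-elim (¬p refl)
    where import Data.Empty

-- G ⊔ K₁ : the new isolated vertex is the vertex 'zero' of Fin (suc n);
-- old vertex i of G becomes 'suc i'.
addIsolated : ∀ {n} → Graph n → Graph (suc n)
addIsolated {n} G = record { adj = a ; adj-sym = s ; irrefl = r }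
  where
  open import Relation.Binary.PropositionalEquality using (refl)
  a : Fin (suc n) → Fin (suc n) → Bool
  a zero    _       = false
  a (suc i) zero    = false
  a (suc i) (suc j) = adj G i j
  s : ∀ i j → a i j ≡ a j i
  s zero zero = refl
  s zero (suc j) = refl
  s (suc i) zero = refl
  s (suc i) (suc j) = adj-sym G i j
  r : ∀ i → a i i ≡ false
  r zero = refl
  r (suc i) = irrefl G i

module Matrices {c ℓ ℓ'} (ℝ : RealField c ℓ ℓ') where
  open RealField ℝ using (Carrier; _≈_; _+_; _*_; 0#)

  Matrix : ℕ → Set c
  Matrix n = Fin n → Fin n → Carrier

  Vector : ℕ → Set c
  Vector n = Fin n → Carrier

  ∑ : ∀ {n} → (Fin n → Carrier) → Carrier
  ∑ {zero}  f = 0#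
  ∑ {suc n} f = f zero + ∑ (λ i → f (suc i))

  _⊗_ : ∀ {n} → Matrix n → Matrix n → Matrix n
  (A ⊗ B) i j = ∑ (λ k → A i k * B k j)

  _·_ : ∀ {n} → Matrix n → Vector n → Vector n
  (A · x) i = ∑ (λ k → A i k * x k)

  IsZeroMatrix : ∀ {n} → Matrix n → Set ℓ
  IsZeroMatrix A = ∀ i j → A i j ≈ 0#

  NowhereZero : ∀ {n} → Vector n → Set ℓ
  NowhereZero x = ∀ i → ¬ (x i ≈ 0#)

  InKernel : ∀ {n} → Vector n → Matrix n → Set ℓ
  InKernel x B = ∀ i → (B · x) i ≈ 0#

  InS : ∀ {n} → Graph n → Matrix n → Set ℓ
  InS G A = (∀ i j → A i j ≈ A j i) ×
            (∀ i j → ¬ (i ≡ j) → ((¬ (A i j ≈ 0#)) ⇔ T (adj G i j)))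

  β-robust : ∀ {n} → Graph n → Set (c ⊔ ℓ)
  β-robust {n} G = Σ (Matrix n) λ A → Σ (Matrix n) λ B →
    InS G A × InS (complement G) B × IsZeroMatrix (A ⊗ B) ×
    Σ (Vector n) λ x → NowhereZero x × InKernel x B

{-# OPTIONS --safe #-}
module Submission where

-- Border A with a zero row and column, and B with the row and column -Bx
-- (corner ⟨Bx, x⟩).  AB = O gives A(Bx) = 0, so the bordered product still
-- vanishes; B's border is nowhere-zero, matching the new vertex being adjacent
-- to every vertex in the complement of G ⊔ K₁; and (1, x) lies in the kernel
-- of the bordered B because the corner cancels ⟨-Bx, x⟩.

open import Defs
open import Data.Nat using (ℕ; zero; suc)
open import Data.Fin using (Fin; zero; suc)
open import Data.Product using (Σ; _×_; _,_)
open import Data.Bool using (false; T)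
open import Data.Empty using (⊥-elim)
open import Data.Unit using (tt)
open import Data.Vec.Functional using (_∷_; map; replicate)
open import Relation.Nullary using (¬_)
open import Relation.Binary.PropositionalEquality as ≡ using (_≡_)
open import Function.Bundles using (_⇔_; mk⇔)
import Algebra.Properties.Semiring.Sum as SemiringSum
import Algebra.Properties.Ring as RingProperties
import Algebra.Properties.Group as GroupProperties
import Relation.Binary.Reasoning.Setoid as SetoidReasoning

module Bordering {c ℓ ℓ'} (ℝ : RealField c ℓ ℓ') where
  open RealField ℝ hiding (zero)
  open Matrices ℝ
  open SemiringSum semiring using (sum; sum-cong-≋; sum-replicate-zero; *-distribˡ-sum; *-distribʳ-sum)
    renaming (∑-comm to sum-comm)
  open RingProperties ring using (-1*x≈-x; -‿distribˡ-*; -‿distribʳ-*)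
  open GroupProperties +-group using (ε⁻¹≈ε; ⁻¹-injective)
  open SetoidReasoning setoid

  ∑≡sum : ∀ {n} (f : Vector n) → ∑ f ≡ sum f
  ∑≡sum {zero}  f = ≡.refl
  ∑≡sum {suc n} f = ≡.cong (f zero +_) (∑≡sum (λ i → f (suc i)))

  ∑-cong : ∀ {n} {f g : Vector n} → (∀ i → f i ≈ g i) → ∑ f ≈ ∑ g
  ∑-cong {f = f} {g} f≈g = begin
    ∑ f   ≡⟨ ∑≡sum f ⟩
    sum f ≈⟨ sum-cong-≋ f≈g ⟩
    sum g ≡⟨ ∑≡sum g ⟨
    ∑ g   ∎

  ∑-zero : ∀ {n} {f : Vector n} → (∀ i → f i ≈ 0#) → ∑ f ≈ 0#
  ∑-zero {n} f≈0 = trans (∑-cong f≈0) (trans (reflexive (∑≡sum (replicate n 0#))) (sum-replicate-zero n))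

  *-distribˡ-∑ : ∀ {n} a (f : Vector n) → a * ∑ f ≈ ∑ (λ i → a * f i)
  *-distribˡ-∑ a f = begin
    a * ∑ f                ≡⟨ ≡.cong (a *_) (∑≡sum f) ⟩
    a * sum f              ≈⟨ *-distribˡ-sum a f ⟩
    sum (λ i → a * f i)    ≡⟨ ∑≡sum (λ i → a * f i) ⟨
    ∑ (λ i → a * f i)      ∎

  *-distribʳ-∑ : ∀ {n} a (f : Vector n) → ∑ f * a ≈ ∑ (λ i → f i * a)
  *-distribʳ-∑ a f = begin
    ∑ f * a                ≡⟨ ≡.cong (_* a) (∑≡sum f) ⟩
    sum f * a              ≈⟨ *-distribʳ-sum a f ⟩
    sum (λ i → f i * a)    ≡⟨ ∑≡sum (λ i → f i * a) ⟨
    ∑ (λ i → f i * a)      ∎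

  ∑-comm : ∀ {m n} (f : Fin m → Fin n → Carrier) →
           ∑ (λ i → ∑ (λ j → f i j)) ≈ ∑ (λ j → ∑ (λ i → f i j))
  ∑-comm f = begin
    ∑ (λ i → ∑ (λ j → f i j))       ≈⟨ ∑-cong (λ i → reflexive (∑≡sum (f i))) ⟩
    ∑ (λ i → sum (λ j → f i j))     ≡⟨ ∑≡sum (λ i → sum (f i)) ⟩
    sum (λ i → sum (λ j → f i j))   ≈⟨ sum-comm f ⟩
    sum (λ j → sum (λ i → f i j))   ≡⟨ ∑≡sum (λ j → sum (λ i → f i j)) ⟨
    ∑ (λ j → sum (λ i → f i j))     ≈⟨ ∑-cong (λ j → reflexive (∑≡sum (λ i → f i j))) ⟨
    ∑ (λ j → ∑ (λ i → f i j))       ∎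

  -‿distrib-∑ : ∀ {n} (f : Vector n) → ∑ (λ i → - f i) ≈ - ∑ f
  -‿distrib-∑ f = begin
    ∑ (λ i → - f i)       ≈⟨ ∑-cong (λ i → -1*x≈-x (f i)) ⟨
    ∑ (λ i → - 1# * f i)  ≈⟨ *-distribˡ-∑ (- 1#) f ⟨
    - 1# * ∑ f            ≈⟨ -1*x≈-x (∑ f) ⟩
    - ∑ f                 ∎

  map-neg-nowhereZero : ∀ {n} {v : Vector n} → NowhereZero v → NowhereZero (map -_ v)
  map-neg-nowhereZero v≉0 i -vᵢ≈0 = v≉0 i (⁻¹-injective (trans -vᵢ≈0 (sym ε⁻¹≈ε)))

  ∷-nowhereZero : ∀ {n a} {v : Vector n} → ¬ (a ≈ 0#) → NowhereZero v → NowhereZero (a ∷ v)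
  ∷-nowhereZero a≉0 v≉0 zero    = a≉0
  ∷-nowhereZero a≉0 v≉0 (suc i) = v≉0 i

  ⊗-·-assoc : ∀ {n} (A B : Matrix n) (x : Vector n) i → ((A ⊗ B) · x) i ≈ (A · (B · x)) i
  ⊗-·-assoc A B x i = begin
    ∑ (λ l → ∑ (λ k → A i k * B k l) * x l)      ≈⟨ ∑-cong (λ l → *-distribʳ-∑ (x l) (λ k → A i k * B k l)) ⟩
    ∑ (λ l → ∑ (λ k → (A i k * B k l) * x l))    ≈⟨ ∑-comm (λ k l → (A i k * B k l) * x l) ⟨
    ∑ (λ k → ∑ (λ l → (A i k * B k l) * x l))    ≈⟨ ∑-cong (λ k → ∑-cong (λ l → *-assoc (A i k) (B k l) (x l))) ⟩
    ∑ (λ k → ∑ (λ l → A i k * (B k l * x l)))    ≈⟨ ∑-cong (λ k → *-distribˡ-∑ (A i k) (λ l → B k l * x l)) ⟨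
    ∑ (λ k → A i k * ∑ (λ l → B k l * x l))      ∎

  zero-· : ∀ {n} {M : Matrix n} → IsZeroMatrix M → ∀ x i → (M · x) i ≈ 0#
  zero-· M≈0 x i = ∑-zero (λ k → trans (*-congʳ (M≈0 i k)) (zeroˡ (x k)))

  ·-map-neg : ∀ {n} (M : Matrix n) (v : Vector n) i → (M · map -_ v) i ≈ - (M · v) i
  ·-map-neg M v i = trans (∑-cong (λ k → sym (-‿distribʳ-* (M i k) (v k)))) (-‿distrib-∑ (λ k → M i k * v k))

  ·-map-neg-image-zero : ∀ {n} {A B : Matrix n} → IsZeroMatrix (A ⊗ B) →
                         ∀ x i → (A · map -_ (B · x)) i ≈ 0#
  ·-map-neg-image-zero {A = A} {B} AB≈0 x i = begin
    (A · map -_ (B · x)) i  ≈⟨ ·-map-neg A (B · x) i ⟩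
    - (A · (B · x)) i       ≈⟨ -‿cong (⊗-·-assoc A B x i) ⟨
    - ((A ⊗ B) · x) i       ≈⟨ -‿cong (zero-· AB≈0 x i) ⟩
    - 0#                    ≈⟨ ε⁻¹≈ε ⟩
    0#                      ∎

  border : ∀ {n} → Carrier → Vector n → Matrix n → Matrix (suc n)
  border d v M zero    zero    = d
  border d v M zero    (suc j) = v j
  border d v M (suc i) zero    = v i
  border d v M (suc i) (suc j) = M i j

  border-sym : ∀ {n} d (v : Vector n) {M : Matrix n} → (∀ i j → M i j ≈ M j i) →
               ∀ i j → border d v M i j ≈ border d v M j i
  border-sym d v M-sym zero    zero    = refl
  border-sym d v M-sym zero    (suc j) = refl
  border-sym d v M-sym (suc i) zero    = refl
  border-sym d v M-sym (suc i) (suc j) = M-sym i j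

  ¬0≉0⇔false : (¬ (0# ≈ 0#)) ⇔ T false
  ¬0≉0⇔false = mk⇔ (λ 0≉0 → 0≉0 refl) (λ ())

  InS-addIsolated : ∀ {n} (G : Graph n) {A : Matrix n} → InS G A →
                    InS (addIsolated G) (border 0# (replicate n 0#) A)
  InS-addIsolated {n} G {A} (A-sym , A-pattern) = border-sym 0# (replicate n 0#) A-sym , adjacency
    where
    adjacency : ∀ i j → ¬ (i ≡ j) →
                (¬ (border 0# (replicate n 0#) A i j ≈ 0#)) ⇔ T (adj (addIsolated G) i j)
    adjacency zero    zero    _   = ¬0≉0⇔false
    adjacency zero    (suc j) _   = ¬0≉0⇔false
    adjacency (suc i) zero    _   = ¬0≉0⇔false
    adjacency (suc i) (suc j) i≢j = A-pattern i j (λ i≡j → i≢j (≡.cong suc i≡j))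

  InS-complement-addIsolated : ∀ {n} (G : Graph n) {B : Matrix n} d {v : Vector n} →
                               InS (complement G) B → NowhereZero v →
                               InS (complement (addIsolated G)) (border d v B)
  InS-complement-addIsolated G {B} d {v} (B-sym , B-pattern) v≉0 = border-sym d v B-sym , adjacency
    where
    adjacency : ∀ i j → ¬ (i ≡ j) →
                (¬ (border d v B i j ≈ 0#)) ⇔ T (adj (complement (addIsolated G)) i j)
    adjacency zero    zero    i≢j = ⊥-elim (i≢j ≡.refl)
    adjacency zero    (suc j) _   = mk⇔ (λ _ → tt) (λ _ → v≉0 j)
    adjacency (suc i) zero    _   = mk⇔ (λ _ → tt) (λ _ → v≉0 i)
    adjacency (suc i) (suc j) i≢j = B-pattern i j (λ i≡j → i≢j (≡.cong suc i≡j))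

  0*a+b≈b : ∀ a {b} → 0# * a + b ≈ b
  0*a+b≈b a = trans (+-congʳ (zeroˡ a)) (+-identityˡ _)

  border-⊗-zero : ∀ {n} {A B : Matrix n} d {v : Vector n} →
                  IsZeroMatrix (A ⊗ B) → (∀ i → (A · v) i ≈ 0#) →
                  IsZeroMatrix (border 0# (replicate n 0#) A ⊗ border d v B)
  border-⊗-zero {B = B} d {v} AB≈0 Av≈0 zero j = ∑-zero (λ k → zeroˡ (border d v B k j))
  border-⊗-zero d AB≈0 Av≈0 (suc i) zero    = trans (0*a+b≈b d) (Av≈0 i)
  border-⊗-zero d AB≈0 Av≈0 (suc i) (suc j) = trans (0*a+b≈b _) (AB≈0 i j)

  InKernel-border : ∀ {n} (B : Matrix n) (x : Vector n) →
                    let y = B · x in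
                    InKernel (1# ∷ x) (border (∑ (λ k → y k * x k)) (map -_ y) B)
  InKernel-border B x zero = begin
    ∑ (λ k → y k * x k) * 1# + ∑ (λ k → - y k * x k)
      ≈⟨ +-cong (*-identityʳ _) (∑-cong (λ k → sym (-‿distribˡ-* (y k) (x k)))) ⟩
    ∑ (λ k → y k * x k) + ∑ (λ k → - (y k * x k))
      ≈⟨ +-congˡ (-‿distrib-∑ (λ k → y k * x k)) ⟩
    ∑ (λ k → y k * x k) + - ∑ (λ k → y k * x k)
      ≈⟨ -‿inverseʳ _ ⟩
    0# ∎
    where y = B · x
  InKernel-border B x (suc i) = trans (+-congʳ (*-identityʳ _)) (-‿inverseˡ ((B · x) i))

lemma3p4 : ∀ {c ℓ ℓ'} (ℝ : RealField c ℓ ℓ') → let open Matrices ℝ in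
    ∀ {n : ℕ} (G : Graph n) →
    Σ (Matrix n) (λ A → Σ (Matrix n) λ B → Σ (Vector n) λ x →
      InS G A × InS (complement G) B × IsZeroMatrix (A ⊗ B) ×
      NowhereZero x × NowhereZero (B · x)) →
    β-robust (addIsolated G)
lemma3p4 ℝ {n} G (A , B , x , A∈S , B∈S , AB≈0 , x≉0 , Bx≉0) =
  border 0# (replicate n 0#) A , border d (map -_ y) B ,
  InS-addIsolated G A∈S ,
  InS-complement-addIsolated G d B∈S (map-neg-nowhereZero Bx≉0) ,
  border-⊗-zero d AB≈0 (·-map-neg-image-zero AB≈0 x) ,
  1# ∷ x , ∷-nowhereZero 1≉0 x≉0 , InKernel-border B x
  where
  open RealField ℝ hiding (zero)
  open Matrices ℝ
  open Bordering ℝ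

  y : Vector n
  y = B · x

  d : Carrier
  d = ∑ (λ k → y k * x k)
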